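{- Let $\mathbb A=(A,+)$ be a monoid with identity $0$, let $X,Y\subseteq A$ and let $m$ be a positive integer such that $mX+2Y\not\subseteq X+Y$. Put $Z:=(mX+2Y)\setminus(X+Y)$, fix $z\in Z$, and choose $x_z\in(m-1)X$ and $y_z\in Y$ with $z\in x_z+X+Y+y_z$ (where $0X:=\{0\}$). Define $\tilde Y_z:=\{y\in Y: z\in x_z+X+Y+y\}$ and $Y_z:=Y\setminus\tilde Y_z$. If $Y_z\neq\emptyset$, then: (i) $Y_z$ and $\tilde Y_z$ are non-empty disjoint proper subsets of $Y$, and $\tilde Y_z=Y\setminus Y_z$; (ii) if $\mathbb A$ is cancellative, then $(x_z+X+Y_z)\cup(z-\tilde Y_z)\subseteq x_z+X+Y$; (iii) if $\langle Y\rangle$ is commutative, then $(x_z+X+Y_z)\cap(z-\tilde Y_z)=\emptyset$; (iv) if $\mathbb A$ is cancellative, then $|z-\tilde Y_z|\ge|\tilde Y_z|$; (v) if $\mathbb A$ is cancellative and $\langle Y\rangle$ is commutative, then $|X+Y|+|Y_z|\ge|X+Y_z|+|Y|$.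
   Context: Monoids are written additively and need not be commutative; cancellative means $w+x=w+y$ or $x+w=y+w$ implies $x=y$. $X+Y:=\{x+y:x\in X,y\in Y\}$, $nX:=X+\cdots+X$ ($n$ summands), and for $z\in A$, $W\subseteq A$: $z-W:=\{w\in A:(w+W)\cap\{z\}\neq\emptyset\}=\{w\in A: w+y=z\text{ for some }y\in W\}$. $\langle Y\rangle$ is the subsemigroup generated by $Y$. -}

module Defs where

open import Level using (0ℓ)
open import Data.Nat using (ℕ; zero; suc)
open import Data.Product using (Σ; ∃; ∃-syntax; _×_; _,_; proj₁)
open import Data.Sum using (_⊎_; inj₁; inj₂)
open import Data.Empty using (⊥)
open import Relation.Nullary using (¬_)
open import Relation.Binary.PropositionalEquality using (_≡_)
open import Relation.Unary using (Pred; _∈_; _∉_; _⊆_; ｛_｝; _∖_)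
open import Algebra.Structures using (IsMonoid)

record MonoidStr : Set₁ where
  field
    Carrier  : Set
    _+_      : Carrier → Carrier → Carrier
    0#       : Carrier
    isMonoid : IsMonoid _≡_ _+_ 0#

module Ops (M : MonoidStr) where
  open MonoidStr M

  Subset : Set₁
  Subset = Pred Carrier 0ℓ

  _⊕_ : Subset → Subset → Subset
  (X ⊕ Y) a = ∃[ x ] ∃[ y ] (x ∈ X × y ∈ Y × a ≡ x + y)

  infixl 6 _⊕_

  mul : ℕ → Subset → Subset
  mul zero X = ｛ 0# ｝
  mul (suc zero) X = X
  mul (suc (suc n)) X = X ⊕ mul (suc n) X

  _⊖_ : Carrier → Subset → Subset
  (z ⊖ W) w = ∃[ y ] (y ∈ W × w + y ≡ z)

  Cancellative : Set
  Cancellative = ∀ w x y → (w + x ≡ w + y ⊎ x + w ≡ y + w) → x ≡ y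

  data Gen (Y : Subset) : Subset where
    gen  : ∀ {y} → y ∈ Y → Gen Y y
    plus : ∀ {a b} → Gen Y a → Gen Y b → Gen Y (a + b)

  CommutativeGen : Subset → Set
  CommutativeGen Y = ∀ a b → a ∈ Gen Y → b ∈ Gen Y → a + b ≡ b + a

  _⊂_ : Subset → Subset → Set
  P ⊂ Q = P ⊆ Q × ¬ (Q ⊆ P)

  Elem : Subset → Set
  Elem P = Σ Carrier P

  -- |P| ≤ |Q| (cardinals): an injection P ↪ Q
  _≤ᶜ_ : Subset → Subset → Set
  P ≤ᶜ Q = Σ (Elem P → Elem Q) λ f →
    ∀ (u v : Elem P) → proj₁ (f u) ≡ proj₁ (f v) → proj₁ u ≡ proj₁ v

  under : ∀ {P Q : Subset} → Elem P ⊎ Elem Q → Carrier ⊎ Carrier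
  under (inj₁ (a , _)) = inj₁ a
  under (inj₂ (a , _)) = inj₂ a

  -- |P₁| + |P₂| ≤ |Q₁| + |Q₂| (cardinal sums): an injection P₁ ⊔ P₂ ↪ Q₁ ⊔ Q₂
  Sum≤ᶜ : Subset → Subset → Subset → Subset → Set
  Sum≤ᶜ P₁ P₂ Q₁ Q₂ =
    Σ (Elem P₁ ⊎ Elem P₂ → Elem Q₁ ⊎ Elem Q₂) λ f →
      ∀ u v → under {Q₁} {Q₂} (f u) ≡ under (f v) → under {P₁} {P₂} u ≡ under v

  Ytilde : Subset → Subset → Carrier → Carrier → Subset
  Ytilde X Y xz z y = y ∈ Y × z ∈ ｛ xz ｝ ⊕ X ⊕ Y ⊕ ｛ y ｝

  Yminus : Subset → Subset → Carrier → Carrier → Subset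
  Yminus X Y xz z = Y ∖ Ytilde X Y xz z

-- Everything is driven by the identity z = (x_z + s) + y, s ∈ X + Y, which
-- characterises y ∈ Ỹ_z.  Right cancellation of y shows that z − Ỹ_z lies in
-- x_z + X + Y, and left cancellation of x_z + s makes y ↦ x_z + s injective.
-- If ⟨Y⟩ is commutative, then w = c + y' with y' ∈ Y_z and w + y = z for some
-- y ∈ Y would give z = (c + y) + y', i.e. y' ∈ Ỹ_z; so x_z + X + Y_z misses z − Y.
-- For (v), send X + Y_z into X + Y by inclusion, the elements of Y_z to
-- themselves, and y ∈ Ỹ_z to its s: this is injective by left cancellation,
-- and the two parts landing in X + Y cannot collide by the disjointness above.
module Submission where

open import Defs
open import Level using (0ℓ)
open import Axiom.ExcludedMiddle using (ExcludedMiddle)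
open import Data.Nat using (ℕ; _≤_; _∸_)
open import Data.Product using (_×_; _,_; proj₁; proj₂; Σ-syntax; ∃-syntax)
open import Data.Sum using (_⊎_; inj₁; inj₂)
open import Data.Sum.Properties using (inj₁-injective; inj₂-injective)
open import Relation.Nullary using (¬_; Dec; yes; no; contradiction)
open import Relation.Binary.PropositionalEquality
  using (_≡_; _≢_; refl; sym; trans; cong; subst; module ≡-Reasoning)
open import Relation.Unary using (_∈_; _⊆_; _≐_; _∪_; _∩_; _∖_; ｛_｝; Empty; Satisfiable)
open import Algebra.Structures using (IsMonoid)

module Sumsets (M : MonoidStr) where
  open MonoidStr M
  open Ops M

  +-assoc : ∀ a b c → (a + b) + c ≡ a + (b + c)
  +-assoc = IsMonoid.assoc isMonoid

  cancelˡ : Cancellative → ∀ w {x y} → w + x ≡ w + y → x ≡ y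
  cancelˡ canc w eq = canc w _ _ (inj₁ eq)

  cancelʳ : Cancellative → ∀ w {x y} → x + w ≡ y + w → x ≡ y
  cancelʳ canc w eq = canc w _ _ (inj₂ eq)

  ⊕-monoʳ : ∀ {P Q Q′ : Subset} → Q ⊆ Q′ → P ⊕ Q ⊆ P ⊕ Q′
  ⊕-monoʳ Q⊆Q′ (x , y , xP , yQ , eq) = x , y , xP , Q⊆Q′ yQ , eq

  ⊖-mono : ∀ {z} {W W′ : Subset} → W ⊆ W′ → z ⊖ W ⊆ z ⊖ W′
  ⊖-mono W⊆W′ (y , yW , eq) = y , W⊆W′ yW , eq

  ∈-⊕｛｝⁻ : ∀ {P : Subset} {a c} → c ∈ P ⊕ ｛ a ｝ → ∃[ b ] (b ∈ P × c ≡ b + a)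
  ∈-⊕｛｝⁻ (b , _ , bP , refl , eq) = b , bP , eq

  ∈-｛｝⊕⊕⁺ : ∀ {P Q : Subset} {a b} → b ∈ P ⊕ Q → a + b ∈ ｛ a ｝ ⊕ P ⊕ Q
  ∈-｛｝⊕⊕⁺ {a = a} (p , q , pP , qQ , refl) =
    a + p , q , (a , p , refl , pP , refl) , qQ , sym (+-assoc a p q)

  ∈-｛｝⊕⊕⁻ : ∀ {P Q : Subset} {a c} → c ∈ ｛ a ｝ ⊕ P ⊕ Q → ∃[ b ] (b ∈ P ⊕ Q × c ≡ a + b)
  ∈-｛｝⊕⊕⁻ (_ , q , (a , p , refl , pP , refl) , qQ , refl) =
    p + q , (p , q , pP , qQ , refl) , +-assoc a p q

  RightSummands : Carrier → Subset
  RightSummands z y = ∃[ w ] (w + y ≡ z)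

  ≤ᶜ-⊖ : Cancellative → ∀ {z} {W : Subset} → W ⊆ RightSummands z → W ≤ᶜ (z ⊖ W)
  ≤ᶜ-⊖ canc {z} {W} W⊆ = f , f-injective
    where
    f : Elem W → Elem (z ⊖ W)
    f (y , yW) = proj₁ (W⊆ yW) , y , yW , proj₂ (W⊆ yW)

    f-injective : ∀ u v → proj₁ (f u) ≡ proj₁ (f v) → proj₁ u ≡ proj₁ v
    f-injective (y , yW) (y′ , y′W) eq with W⊆ yW | W⊆ y′W
    ... | w , w+y≡z | _ , w′+y′≡z rewrite eq =
      cancelˡ canc _ (trans w+y≡z (sym w′+y′≡z))

  module Decomposition (X Y : Subset) (xz z : Carrier) where
    Ỹ Y⁻ : Subset
    Ỹ = Ytilde X Y xz z
    Y⁻ = Yminus X Y xz z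

    Ytilde-split : ∀ {y} → y ∈ Ỹ → Σ[ s ∈ Elem (X ⊕ Y) ] z ≡ (xz + proj₁ s) + y
    Ytilde-split (_ , z∈) with ∈-⊕｛｝⁻ z∈
    ... | a , a∈ , z≡a+y with ∈-｛｝⊕⊕⁻ a∈
    ...   | s , s∈ , refl = (s , s∈) , z≡a+y

    Ytilde⊆RightSummands : Ỹ ⊆ RightSummands z
    Ytilde⊆RightSummands (_ , z∈) with ∈-⊕｛｝⁻ z∈
    ... | a , _ , z≡a+y = a , sym z≡a+y

    Y∖Yminus⊆Ytilde : ExcludedMiddle 0ℓ → Y ∖ Y⁻ ⊆ Ỹ
    Y∖Yminus⊆Ytilde em {y} (yY , y∉Y⁻) with em {y ∈ Ỹ}
    ... | yes y∈Ỹ = y∈Ỹ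
    ... | no y∉Ỹ = contradiction (yY , y∉Ỹ) y∉Y⁻

    ⊖Ytilde⊆｛xz｝⊕X⊕Y : Cancellative → z ⊖ Ỹ ⊆ ｛ xz ｝ ⊕ X ⊕ Y
    ⊖Ytilde⊆｛xz｝⊕X⊕Y canc (y , (_ , z∈) , w+y≡z) with ∈-⊕｛｝⁻ z∈
    ... | a , a∈ , z≡a+y = subst (_∈ ｛ xz ｝ ⊕ X ⊕ Y) (sym (cancelʳ canc y (trans w+y≡z z≡a+y))) a∈

    ｛xz｝⊕X⊕Yminus∩⊖Y-empty : CommutativeGen Y → Empty ((｛ xz ｝ ⊕ X ⊕ Y⁻) ∩ (z ⊖ Y))
    ｛xz｝⊕X⊕Yminus∩⊖Y-empty comm _ ((c , y′ , c∈ , (y′Y , y′∉Ỹ) , refl) , y , yY , w+y≡z) =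
      y′∉Ỹ (y′Y , c + y , y′ , (c , y , c∈ , yY , refl) , refl , z≡c+y+y′)
      where
      open ≡-Reasoning
      z≡c+y+y′ : z ≡ (c + y) + y′
      z≡c+y+y′ = begin
        z                ≡⟨ sym w+y≡z ⟩
        (c + y′) + y     ≡⟨ +-assoc c y′ y ⟩
        c + (y′ + y)     ≡⟨ cong (c +_) (comm y′ y (gen y′Y) (gen yY)) ⟩
        c + (y + y′)     ≡⟨ sym (+-assoc c y y′) ⟩
        (c + y) + y′     ∎

    module _ (canc : Cancellative) (comm : CommutativeGen Y) where
      classify : ∀ {y} → y ∈ Y → Dec (y ∈ Ỹ) → Elem (X ⊕ Y) ⊎ Elem Y⁻
      classify yY (yes y∈Ỹ) = inj₁ (proj₁ (Ytilde-split y∈Ỹ))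
      classify yY (no y∉Ỹ) = inj₂ (_ , yY , y∉Ỹ)

      classify-injective : ∀ {y y′} (yY : y ∈ Y) (y′Y : y′ ∈ Y) d d′ →
        under {X ⊕ Y} {Y⁻} (classify yY d) ≡ under (classify y′Y d′) → y ≡ y′
      classify-injective {y} {y′} _ _ (yes y∈Ỹ) (yes y′∈Ỹ) eq
        with Ytilde-split y∈Ỹ | Ytilde-split y′∈Ỹ | inj₁-injective eq
      ... | (s , _) , z≡s+y | (_ , _) , z≡s′+y′ | refl =
        cancelˡ canc (xz + s) (trans (sym z≡s+y) z≡s′+y′)
      classify-injective _ _ (no _) (no _) eq = inj₂-injective eq

      classify-avoids-X⊕Yminus : ∀ {w y} → w ∈ X ⊕ Y⁻ → (yY : y ∈ Y) → ∀ d →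
        under {X ⊕ Y} {Y⁻} (classify yY d) ≢ inj₁ w
      classify-avoids-X⊕Yminus w∈ yY (yes y∈Ỹ) eq with Ytilde-split y∈Ỹ | inj₁-injective eq
      ... | _ , z≡s+y | refl =
        ｛xz｝⊕X⊕Yminus∩⊖Y-empty comm _ (∈-｛｝⊕⊕⁺ w∈ , _ , yY , sym z≡s+y)

      X⊕Yminus,Y≤ᶜX⊕Y,Yminus : ExcludedMiddle 0ℓ → Sum≤ᶜ (X ⊕ Y⁻) Y (X ⊕ Y) Y⁻
      X⊕Yminus,Y≤ᶜX⊕Y,Yminus em = f , f-injective
        where
        f : Elem (X ⊕ Y⁻) ⊎ Elem Y → Elem (X ⊕ Y) ⊎ Elem Y⁻
        f (inj₁ (w , w∈)) = inj₁ (w , ⊕-monoʳ proj₁ w∈)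
        f (inj₂ (y , yY)) = classify yY em

        f-injective : ∀ u v → under {X ⊕ Y} {Y⁻} (f u) ≡ under (f v) →
                      under {X ⊕ Y⁻} {Y} u ≡ under v
        f-injective (inj₁ _) (inj₁ _) refl = refl
        f-injective (inj₁ (_ , w∈)) (inj₂ (_ , yY)) eq =
          contradiction (sym eq) (classify-avoids-X⊕Yminus w∈ yY em)
        f-injective (inj₂ (_ , yY)) (inj₁ (_ , w∈)) eq =
          contradiction eq (classify-avoids-X⊕Yminus w∈ yY em)
        f-injective (inj₂ (_ , yY)) (inj₂ (_ , y′Y)) eq =
          cong inj₂ (classify-injective yY y′Y em em eq)

proposition4p1 : ExcludedMiddle 0ℓ → (M : MonoidStr) →
    let open MonoidStr M in let open Ops M in
    (X Y : Subset) (m : ℕ) → 1 ≤ m →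
    ¬ (mul m X ⊕ mul 2 Y ⊆ X ⊕ Y) →
    (z : Carrier) → z ∈ (mul m X ⊕ mul 2 Y) ∖ (X ⊕ Y) →
    (xz yz : Carrier) → xz ∈ mul (m ∸ 1) X → yz ∈ Y →
    z ∈ ｛ xz ｝ ⊕ X ⊕ Y ⊕ ｛ yz ｝ →
    Satisfiable (Yminus X Y xz z) →
      (Satisfiable (Yminus X Y xz z) × Satisfiable (Ytilde X Y xz z)
        × Empty (Yminus X Y xz z ∩ Ytilde X Y xz z)
        × Yminus X Y xz z ⊂ Y × Ytilde X Y xz z ⊂ Y
        × Ytilde X Y xz z ≐ (Y ∖ Yminus X Y xz z))
      × (Cancellative →
          ((｛ xz ｝ ⊕ X ⊕ Yminus X Y xz z) ∪ (z ⊖ Ytilde X Y xz z)) ⊆ ｛ xz ｝ ⊕ X ⊕ Y)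
      × (CommutativeGen Y →
          Empty ((｛ xz ｝ ⊕ X ⊕ Yminus X Y xz z) ∩ (z ⊖ Ytilde X Y xz z)))
      × (Cancellative → Ytilde X Y xz z ≤ᶜ (z ⊖ Ytilde X Y xz z))
      × (Cancellative → CommutativeGen Y →
          Sum≤ᶜ (X ⊕ Yminus X Y xz z) Y (X ⊕ Y) (Yminus X Y xz z))
proposition4p1 em M X Y _ _ _ z _ xz yz _ yzY z∈ Y⁻≠∅@(y₀ , y₀Y , y₀∉Ỹ) =
  ( Y⁻≠∅ , (yz , yzY∈Ỹ) , (λ _ ((_ , y∉Ỹ) , y∈Ỹ) → y∉Ỹ y∈Ỹ)
  , (proj₁ , λ Y⊆Y⁻ → proj₂ (Y⊆Y⁻ yzY) yzY∈Ỹ)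
  , (proj₁ , λ Y⊆Ỹ → y₀∉Ỹ (Y⊆Ỹ y₀Y))
  , ((λ y∈Ỹ → proj₁ y∈Ỹ , λ y∈Y⁻ → proj₂ y∈Y⁻ y∈Ỹ) , Y∖Yminus⊆Ytilde em) )
  , (λ canc → λ { (inj₁ w∈) → ⊕-monoʳ proj₁ w∈
                ; (inj₂ w∈) → ⊖Ytilde⊆｛xz｝⊕X⊕Y canc w∈ })
  , (λ comm w (w∈ , w∈⊖Ỹ) →
       ｛xz｝⊕X⊕Yminus∩⊖Y-empty comm w (w∈ , ⊖-mono proj₁ w∈⊖Ỹ))
  , (λ canc → ≤ᶜ-⊖ canc Ytilde⊆RightSummands)
  , (λ canc comm → X⊕Yminus,Y≤ᶜX⊕Y,Yminus canc comm em)
  where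
  open Sumsets M
  open Decomposition X Y xz z
  yzY∈Ỹ : yz ∈ Ỹ
  yzY∈Ỹ = yzY , z∈
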